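{- Let $\mathcal{H}$ be a $k$-cactus with a cycle $\mathcal{C}$. Then: (a) if the length of $\mathcal{C}$ is at least three, then $\mathcal{C}$ is linear; (b) $\mathcal{H}$ can be written as $\mathcal{H}=\mathcal{C}(v_1,\ldots,v_s)\ast(\mathcal{H}_1(v_1),\ldots,\mathcal{H}_s(v_s))$, where $v_1,\ldots,v_s\in V(\mathcal{C})$ and $\mathcal{H}_1,\ldots,\mathcal{H}_s$ are pairwise vertex-disjoint connected $k$-graphs.
   Context: A $k$-graph is a finite vertex set with a set of $k$-element subsets (edges). A path is an alternating sequence $(v_0,e_1,v_1,\dots,e_\ell,v_\ell)$ of vertices and pairwise distinct edges with $v_{i-1},v_i\in e_i$ and $v_0,\dots,v_\ell$ pairwise distinct; it is a cycle if instead $v_1,\dots,v_\ell$ are pairwise distinct, $\ell\ge 2$ and $v_0=v_\ell$; $\ell$ is its length and $V(\cdot)=\bigcup_i e_i$; a cycle is viewed as the $k$-graph with vertex set $V(\mathcal{C})$ and edges $e_1,\dots,e_\ell$. A $k$-cactus is a connected $k$-graph in which any two distinct cycles $\mathcal{C}_1,\mathcal{C}_2$ satisfy $|V(\mathcal{C}_1)\cap V(\mathcal{C}_2)|\le 1$. A $k$-graph is linear if any two distinct edges share at most one vertex. For pairwise vertex-disjoint $k$-graphs $\mathcal{G},\mathcal{H}_1,\dots,\mathcal{H}_s$ with $w_i\in V(\mathcal{G})$ and $v_i'\in V(\mathcal{H}_i)$, $\mathcal{G}(w_1,\dots,w_s)\ast(\mathcal{H}_1(v_1'),\dots,\mathcal{H}_s(v_s'))$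 is obtained by identifying $w_i$ with $v_i'$ for each $i$; in (b) the identified vertex is denoted $v_i$ in both (the $\mathcal{H}_i$ being disjoint copies apart from the identified vertex). -}

module Defs where

open import Data.Nat using (ℕ; zero; suc; _≤_)
open import Data.Fin using (Fin; zero; suc; inject₁; fromℕ)
open import Data.Fin.Subset using (Subset; _∈_; _⊆_; ∣_∣)
open import Data.Product using (Σ; ∃; ∃-syntax; _×_)
open import Data.Sum using (_⊎_)
open import Data.Empty using (⊥)
open import Relation.Nullary using (¬_)
open import Relation.Binary.PropositionalEquality using (_≡_; _≢_)
open import Function.Definitions using (Injective)

-- A k-graph on the finite vertex set Fin n with m edges; the edges are
-- indexed by Fin m, each is a k-element subset of Fin n, and the edges are
-- pairwise distinct (so the family is a *set* of k-subsets).
record KGraph (k : ℕ) : Set where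
  field
    n         : ℕ
    m         : ℕ
    edge      : Fin m → Subset n
    edge-size : ∀ e → ∣ edge e ∣ ≡ k
    edge-inj  : Injective _≡_ _≡_ edge
open KGraph public

module _ {k : ℕ} (H : KGraph k) where

  -- A path (v_0, e_1, v_1, ..., e_ℓ, v_ℓ): vertices vert 0..ℓ, edges edg 0..ℓ-1
  -- (edg i is e_{i+1}), edges pairwise distinct, vertices pairwise distinct.
  record Path : Set where
    field
      len      : ℕ
      vert     : Fin (suc len) → Fin (n H)
      edg      : Fin len → Fin (m H)
      edg-inj  : Injective _≡_ _≡_ edg
      vert-inj : Injective _≡_ _≡_ vert
      inc-left  : ∀ i → vert (inject₁ i) ∈ edge H (edg i)
      inc-right : ∀ i → vert (suc i) ∈ edge H (edg i)
  open Path public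

  record Cycle : Set where
    field
      len      : ℕ
      vert     : Fin (suc len) → Fin (n H)
      edg      : Fin len → Fin (m H)
      edg-inj  : Injective _≡_ _≡_ edg
      vert-inj : Injective _≡_ _≡_ (λ i → vert (suc i))
      len≥2    : 2 ≤ len
      closed   : vert zero ≡ vert (fromℕ len)
      inc-left  : ∀ i → vert (inject₁ i) ∈ edge H (edg i)
      inc-right : ∀ i → vert (suc i) ∈ edge H (edg i)
  open Cycle public

  -- the edge set E(C) and the vertex set V(C) = ⋃ e_i of a cycle
  EdgeOf : Cycle → Fin (m H) → Set
  EdgeOf C e = ∃[ i ] Cycle.edg C i ≡ e

  VertexOf : Cycle → Fin (n H) → Set
  VertexOf C x = ∃[ i ] x ∈ edge H (Cycle.edg C i)

  -- two cycles are distinct (as k-graphs) iff their edge sets differ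
  DistinctCycles : Cycle → Cycle → Set
  DistinctCycles C₁ C₂ = ¬ (∀ e → (EdgeOf C₁ e → EdgeOf C₂ e) × (EdgeOf C₂ e → EdgeOf C₁ e))

  AtMostOneCommonVertex : Cycle → Cycle → Set
  AtMostOneCommonVertex C₁ C₂ =
    ∀ x y → VertexOf C₁ x → VertexOf C₂ x → VertexOf C₁ y → VertexOf C₂ y → x ≡ y

  PathWithin : Subset (n H) → Fin (n H) → Fin (n H) → Set
  PathWithin W x y = Σ Path λ p →
    (Path.vert p zero ≡ x) × (Path.vert p (fromℕ (Path.len p)) ≡ y)
      × (∀ i → edge H (Path.edg p i) ⊆ W)

  Connected : Set
  Connected = ∀ x y → Σ Path λ p →
    (Path.vert p zero ≡ x) × (Path.vert p (fromℕ (Path.len p)) ≡ y)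

  -- the sub-k-graph H[W] with vertex set W and edges {e ∈ E(H) : e ⊆ W}
  -- is connected
  ConnectedOn : Subset (n H) → Set
  ConnectedOn W = ∀ x y → x ∈ W → y ∈ W → PathWithin W x y

  Cactus : Set
  Cactus = Connected × (∀ C₁ C₂ → DistinctCycles C₁ C₂ → AtMostOneCommonVertex C₁ C₂)

  LinearCycle : Cycle → Set
  LinearCycle C = ∀ i j → Cycle.edg C i ≢ Cycle.edg C j →
    ∀ x y → x ∈ edge H (Cycle.edg C i) → x ∈ edge H (Cycle.edg C j)
          → y ∈ edge H (Cycle.edg C i) → y ∈ edge H (Cycle.edg C j) → x ≡ y

  -- H = C(v_1,...,v_s) * (H_1(v_1),...,H_s(v_s)) with the H_i pairwise
  -- vertex-disjoint connected k-graphs; H_i has vertex set W i and edge set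
  -- {e ∈ E(H) : e ⊆ W i}.
  Decomposition : Cycle → Set
  Decomposition C =
    Σ ℕ λ s → Σ (Fin s → Fin (n H)) λ v → Σ (Fin s → Subset (n H)) λ W →
        Injective _≡_ _≡_ v
      × (∀ i → VertexOf C (v i))
      × (∀ i → v i ∈ W i)
      × (∀ i x → x ∈ W i → VertexOf C x → x ≡ v i)
      × (∀ i j → i ≢ j → ∀ x → x ∈ W i → x ∈ W j → ⊥)
      × (∀ i → ConnectedOn (W i))
      × (∀ x → VertexOf C x ⊎ ∃[ i ] x ∈ W i)
      × (∀ e → EdgeOf C e ⊎ ∃[ i ] edge H e ⊆ W i)

-- An off-cycle walk (one using no edge of C) cannot join two distinct vertices of C in a cactus:
-- make it simple, follow it from its start x to the first vertex b where it returns to C, and close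
-- it up by a path inside C from b back to x. The result is a cycle using an edge outside C, hence
-- distinct from C, that shares the two vertices x ≠ b with C. So for each vertex v of C the set H_v
-- of vertices reached from v by off-cycle walks meets C only in v, and these sets are pairwise
-- disjoint and connected; as H is connected they cover all vertices, and every edge outside C lies
-- in one of them. Every vertex of C is taken as some v_i, so H_i may be the single vertex v_i.
-- For (a), two edges e ≠ f of C sharing vertices x ≠ y form the 2-cycle x e y f x, which differs
-- from C when C has at least three edges.
module Submission where

open import Defs
open import Data.Nat using (ℕ; zero; suc; _≤_; _<_; s≤s; z≤n)
open import Data.Nat.Properties using (≤-trans; <⇒≤; n≮0)
open import Data.Fin using (Fin; zero; suc; inject₁; fromℕ; fromℕ<)
open import Data.Fin.Properties using (any?; injective⇒≤; _≟_)
open import Data.Fin.Subset using (Subset; _∈_; _⊆_; ∣_∣; Nonempty; _-_)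
open import Data.Fin.Subset.Properties using (_∈?_; nonempty?; Empty-unique; ∣⊥∣≡0; x∈p⇒∣p-x∣<∣p∣)
open import Data.List using (List; filter; lookup; allFin; length)
open import Data.List.Relation.Unary.All as All using ()
open import Data.List.Relation.Unary.AllPairs using (_∷_)
open import Data.List.Relation.Unary.Any using (index)
open import Data.List.Relation.Unary.Any.Properties using (lookup-index)
open import Data.List.Relation.Unary.Unique.Propositional using (Unique)
open import Data.List.Relation.Unary.Unique.Propositional.Properties using (filter⁺; allFin⁺)
open import Data.List.Membership.Propositional.Properties using (∈-lookup; ∈-allFin; ∈-filter⁺; ∈-filter⁻)
open import Data.Vec using (tabulate)
open import Data.Vec.Properties using (lookup∘tabulate; []=⇒lookup; lookup⇒[]=)
open import Data.Product using (Σ; ∃-syntax; _×_; _,_; proj₁; proj₂; uncurry)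
open import Data.Sum using (_⊎_; inj₁; inj₂; [_,_])
open import Data.Unit using (⊤; tt)
open import Data.Empty using (⊥)
open import Relation.Nullary using (Dec; yes; no; ¬_; does; contradiction)
open import Relation.Nullary.Decidable using (_×-dec_; _⊎-dec_; ¬?; dec-true)
open import Relation.Unary using (Decidable)
open import Relation.Binary.PropositionalEquality using (_≡_; _≢_; refl; sym; trans; cong; subst; module ≡-Reasoning)
open import Function using (_∘_)
open import Function.Definitions using (Injective)

lookup-injective : ∀ {A : Set} {xs : List A} → Unique xs → Injective _≡_ _≡_ (lookup xs)
lookup-injective (_ ∷ _)     {zero}  {zero}  _  = refl
lookup-injective (x∉xs ∷ _)  {zero}  {suc j} eq = contradiction eq (All.lookup x∉xs (∈-lookup j))
lookup-injective (x∉xs ∷ _)  {suc i} {zero}  eq = contradiction (sym eq) (All.lookup x∉xs (∈-lookup i))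
lookup-injective (_ ∷ uniq)  {suc i} {suc j} eq = cong suc (lookup-injective uniq eq)

record Enumeration {N : ℕ} (P : Fin N → Set) : Set where
  field
    size       : ℕ
    elem       : Fin size → Fin N
    elem-inj   : Injective _≡_ _≡_ elem
    elem-sat   : ∀ i → P (elem i)
    elem-onto  : ∀ x → P x → ∃[ i ] elem i ≡ x

enumerate : ∀ {N} {P : Fin N → Set} → Decidable P → Enumeration P
enumerate {N} P? = record
  { size      = length xs
  ; elem      = lookup xs
  ; elem-inj  = lookup-injective (filter⁺ P? (allFin⁺ N))
  ; elem-sat  = λ i → proj₂ (∈-filter⁻ P? {xs = allFin N} (∈-lookup i))
  ; elem-onto = λ x Px → let x∈xs = ∈-filter⁺ P? (∈-allFin x) Px in index x∈xs , sym (lookup-index x∈xs)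
  }
  where xs = filter P? (allFin N)

toSubset : ∀ {N} {P : Fin N → Set} → Decidable P → Subset N
toSubset P? = tabulate (does ∘ P?)

∈-toSubset⁻ : ∀ {N} {P : Fin N → Set} (P? : Decidable P) {x} → x ∈ toSubset P? → P x
∈-toSubset⁻ P? {x} x∈ with P? x | trans (sym (lookup∘tabulate _ x)) ([]=⇒lookup x∈)
... | yes Px | _  = Px
... | no  _  | ()

∈-toSubset⁺ : ∀ {N} {P : Fin N → Set} (P? : Decidable P) {x} → P x → x ∈ toSubset P?
∈-toSubset⁺ P? {x} Px = lookup⇒[]= x _ (trans (lookup∘tabulate _ x) (dec-true (P? x) Px))

nonempty-sameSize : ∀ {N} {p q : Subset N} → ∣ p ∣ ≡ ∣ q ∣ → Nonempty p → Nonempty q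
nonempty-sameSize {N} {p} {q} ∣p∣≡∣q∣ (x , x∈p) with nonempty? q
... | yes ne = ne
... | no ¬ne = contradiction (subst (∣ p - x ∣ <_) ∣p∣≡0 (x∈p⇒∣p-x∣<∣p∣ {p = p} x∈p)) n≮0
  where ∣p∣≡0 = trans ∣p∣≡∣q∣ (trans (cong ∣_∣ (Empty-unique ¬ne)) (∣⊥∣≡0 N))

module Walks {k : ℕ} (H : KGraph k) where

  Vertex : Set
  Vertex = Fin (n H)

  Edge : Set
  Edge = Fin (m H)

  infixr 5 _++_
  infix  4 _∈ᵛ_ _∈ᵉ_ _∈ᵛ?_ _∈ᵉ?_ _⊆ᵛ_ _⊆ᵉ_

  private variable
    u v x y z : Vertex
    e : Edge
    P : Edge → Set

  data Walk : Vertex → Vertex → Set where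
    []   : Walk x x
    step : (e : Edge) → x ∈ edge H e → y ∈ edge H e → Walk y z → Walk x z

  single : (e : Edge) → x ∈ edge H e → y ∈ edge H e → Walk x y
  single e x∈e y∈e = step e x∈e y∈e []

  steps : Walk x z → ℕ
  steps []             = 0
  steps (step _ _ _ w) = suc (steps w)

  _++_ : Walk x y → Walk y z → Walk x z
  []                 ++ q = q
  step e x∈e y∈e p   ++ q = step e x∈e y∈e (p ++ q)

  reverse : Walk x y → Walk y x
  reverse []                 = []
  reverse (step e x∈e y∈e w) = reverse w ++ single e y∈e x∈e

  _∈ᵛ_ : Vertex → Walk x z → Set
  u ∈ᵛ [] {x = x}           = u ≡ x
  u ∈ᵛ step {x = x} _ _ _ w = u ≡ x ⊎ u ∈ᵛ w

  _∈ᵉ_ : Edge → Walk x z → Set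
  f ∈ᵉ []           = ⊥
  f ∈ᵉ step e _ _ w = f ≡ e ⊎ f ∈ᵉ w

  _∈ᵛ?_ : (u : Vertex) (w : Walk x z) → Dec (u ∈ᵛ w)
  u ∈ᵛ? []           = u ≟ _
  u ∈ᵛ? step _ _ _ w = (u ≟ _) ⊎-dec (u ∈ᵛ? w)

  _∈ᵉ?_ : (f : Edge) (w : Walk x z) → Dec (f ∈ᵉ w)
  f ∈ᵉ? []           = no λ ()
  f ∈ᵉ? step e _ _ w = (f ≟ e) ⊎-dec (f ∈ᵉ? w)

  _⊆ᵛ_ : Walk x z → Walk y u → Set
  p ⊆ᵛ q = ∀ {v} → v ∈ᵛ p → v ∈ᵛ q

  _⊆ᵉ_ : Walk x z → Walk y u → Set
  p ⊆ᵉ q = ∀ {f} → f ∈ᵉ p → f ∈ᵉ q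

  AllEdges : (Edge → Set) → Walk x z → Set
  AllEdges P w = ∀ {f} → f ∈ᵉ w → P f

  Simple : Walk x z → Set
  Simple []                     = ⊤
  Simple (step {x = x} e _ _ w) = ¬ x ∈ᵛ w × ¬ e ∈ᵉ w × Simple w

  start-∈ᵛ : (w : Walk x z) → x ∈ᵛ w
  start-∈ᵛ []             = refl
  start-∈ᵛ (step _ _ _ _) = inj₁ refl

  end-∈ᵛ : (w : Walk x z) → z ∈ᵛ w
  end-∈ᵛ []             = refl
  end-∈ᵛ (step _ _ _ w) = inj₂ (end-∈ᵛ w)

  ∈ᵛ-++⁻ : (p : Walk x y) {q : Walk y z} → u ∈ᵛ p ++ q → u ∈ᵛ p ⊎ u ∈ᵛ q
  ∈ᵛ-++⁻ []             u∈q           = inj₂ u∈q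
  ∈ᵛ-++⁻ (step _ _ _ p) (inj₁ u≡x)    = inj₁ (inj₁ u≡x)
  ∈ᵛ-++⁻ (step _ _ _ p) (inj₂ u∈p++q) = [ inj₁ ∘ inj₂ , inj₂ ] (∈ᵛ-++⁻ p u∈p++q)

  ∈ᵛ-++⁺ʳ : (p : Walk x y) {q : Walk y z} → u ∈ᵛ q → u ∈ᵛ p ++ q
  ∈ᵛ-++⁺ʳ []             u∈q = u∈q
  ∈ᵛ-++⁺ʳ (step _ _ _ p) u∈q = inj₂ (∈ᵛ-++⁺ʳ p u∈q)

  ∈ᵉ-++⁻ : ∀ {f} (p : Walk x y) {q : Walk y z} → f ∈ᵉ p ++ q → f ∈ᵉ p ⊎ f ∈ᵉ q
  ∈ᵉ-++⁻ []             f∈q           = inj₂ f∈q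
  ∈ᵉ-++⁻ (step _ _ _ p) (inj₁ f≡e)    = inj₁ (inj₁ f≡e)
  ∈ᵉ-++⁻ (step _ _ _ p) (inj₂ f∈p++q) = [ inj₁ ∘ inj₂ , inj₂ ] (∈ᵉ-++⁻ p f∈p++q)

  AllEdges-++ : (p : Walk x y) {q : Walk y z} → AllEdges P p → AllEdges P q → AllEdges P (p ++ q)
  AllEdges-++ p Pp Pq f∈ = [ Pp , Pq ] (∈ᵉ-++⁻ p f∈)

  AllEdges-single : (x∈e : x ∈ edge H e) (y∈e : y ∈ edge H e) → P e → AllEdges P (single e x∈e y∈e)
  AllEdges-single _ _ Pe (inj₁ refl) = Pe

  AllEdges-reverse : (w : Walk x y) → AllEdges P w → AllEdges P (reverse w)
  AllEdges-reverse []                 _  ()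
  AllEdges-reverse (step e x∈e y∈e w) Pw =
    AllEdges-++ (reverse w) (AllEdges-reverse w (Pw ∘ inj₂)) (AllEdges-single y∈e x∈e (Pw (inj₁ refl)))

  ++-Simple : (p : Walk x y) {q : Walk y z} → Simple p → Simple q →
              (∀ {u} → u ∈ᵛ p → u ∈ᵛ q → u ≡ y) → (∀ {f} → f ∈ᵉ p → f ∈ᵉ q → ⊥) →
              Simple (p ++ q)
  ++-Simple []                     _                  sq _     _     = sq
  ++-Simple (step {x = x} e _ _ p) (x∉p , e∉p , sp) sq meetᵛ meetᵉ =
    [ x∉p , (λ x∈q → x∉p (subst (_∈ᵛ p) (sym (meetᵛ (inj₁ refl) x∈q)) (end-∈ᵛ p))) ]
      ∘ ∈ᵛ-++⁻ p ,
    [ e∉p , meetᵉ (inj₁ refl) ] ∘ ∈ᵉ-++⁻ p ,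
    ++-Simple p sp sq (meetᵛ ∘ inj₂) (meetᵉ ∘ inj₂)

  suffixFrom : (w : Walk y z) → Simple w → u ∈ᵛ w → Σ (Walk u z) λ s → Simple s × s ⊆ᵉ w
  suffixFrom []               _            refl        = [] , tt , λ ()
  suffixFrom w@(step _ _ _ _)  sw           (inj₁ refl) = w , sw , λ f∈w → f∈w
  suffixFrom (step _ _ _ w)    (_ , _ , sw) (inj₂ u∈w)  with suffixFrom w sw u∈w
  ... | s , ss , s⊆w = s , ss , inj₂ ∘ s⊆w

  suffixAfter : (w : Walk y z) → Simple w → e ∈ᵉ w →
                ∃[ u ] u ∈ edge H e × Σ (Walk u z) λ s → Simple s × ¬ e ∈ᵉ s × s ⊆ᵛ w × s ⊆ᵉ w
  suffixAfter (step _ _ u∈e w) (_ , e∉w , sw) (inj₁ refl) = _ , u∈e , w , sw , e∉w , inj₂ , inj₂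
  suffixAfter (step _ _ _ w)   (_ , _ , sw)   (inj₂ e∈w)  with suffixAfter w sw e∈w
  ... | u , u∈e , s , ss , e∉s , s⊆ᵛw , s⊆ᵉw =
    u , u∈e , s , ss , e∉s , inj₂ ∘ s⊆ᵛw , inj₂ ∘ s⊆ᵉw

  simplify : (w : Walk x z) → Σ (Walk x z) λ s → Simple s × s ⊆ᵉ w
  simplify []                         = [] , tt , λ ()
  simplify (step {x = x} e x∈e y∈e w) with simplify w
  ... | w′ , sw′ , w′⊆w with x ∈ᵛ? w′ | e ∈ᵉ? w′
  ...   | yes x∈w′ | _ =
    let s , ss , s⊆w′ = suffixFrom w′ sw′ x∈w′
    in  s , ss , inj₂ ∘ w′⊆w ∘ s⊆w′
  ...   | no x∉w′ | yes e∈w′ =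
    let u , u∈e , s , ss , e∉s , s⊆ᵛw′ , s⊆ᵉw′ = suffixAfter w′ sw′ e∈w′
    in  step e x∈e u∈e s , (x∉w′ ∘ s⊆ᵛw′ , e∉s , ss) ,
        [ inj₁ , inj₂ ∘ w′⊆w ∘ s⊆ᵉw′ ]
  ...   | no x∉w′ | no e∉w′ =
    step e x∈e y∈e w′ , (x∉w′ , e∉w′ , sw′) , [ inj₁ , inj₂ ∘ w′⊆w ]

  simplify-AllEdges : (w : Walk x z) → AllEdges P w → Σ (Walk x z) λ s → Simple s × AllEdges P s
  simplify-AllEdges w Pw with simplify w
  ... | s , ss , s⊆w = s , ss , Pw ∘ s⊆w

  vertexAt : (w : Walk x z) → Fin (suc (steps w)) → Vertex
  vertexAt ([] {x = x})           zero    = x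
  vertexAt (step {x = x} _ _ _ _) zero    = x
  vertexAt (step _ _ _ w)         (suc i) = vertexAt w i

  edgeAt : (w : Walk x z) → Fin (steps w) → Edge
  edgeAt (step e _ _ _) zero    = e
  edgeAt (step _ _ _ w) (suc i) = edgeAt w i

  vertexAt-first : (w : Walk x z) → vertexAt w zero ≡ x
  vertexAt-first []             = refl
  vertexAt-first (step _ _ _ _) = refl

  vertexAt-last : (w : Walk x z) → vertexAt w (fromℕ (steps w)) ≡ z
  vertexAt-last []             = refl
  vertexAt-last (step _ _ _ w) = vertexAt-last w

  vertexAt-∈ᵛ : (w : Walk x z) (i : Fin (suc (steps w))) → vertexAt w i ∈ᵛ w
  vertexAt-∈ᵛ []             zero    = refl
  vertexAt-∈ᵛ (step _ _ _ _) zero    = inj₁ refl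
  vertexAt-∈ᵛ (step _ _ _ w) (suc i) = inj₂ (vertexAt-∈ᵛ w i)

  edgeAt-∈ᵉ : (w : Walk x z) (i : Fin (steps w)) → edgeAt w i ∈ᵉ w
  edgeAt-∈ᵉ (step _ _ _ _) zero    = inj₁ refl
  edgeAt-∈ᵉ (step _ _ _ w) (suc i) = inj₂ (edgeAt-∈ᵉ w i)

  vertexAt-inj : (w : Walk x z) → Simple w → Injective _≡_ _≡_ (vertexAt w)
  vertexAt-inj []             _            {zero}  {zero}  _  = refl
  vertexAt-inj (step _ _ _ _) _            {zero}  {zero}  _  = refl
  vertexAt-inj (step _ _ _ w) (x∉w , _)    {zero}  {suc j} eq =
    contradiction (subst (_∈ᵛ w) (sym eq) (vertexAt-∈ᵛ w j)) x∉w
  vertexAt-inj (step _ _ _ w) (x∉w , _)    {suc i} {zero}  eq =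
    contradiction (subst (_∈ᵛ w) eq (vertexAt-∈ᵛ w i)) x∉w
  vertexAt-inj (step _ _ _ w) (_ , _ , sw) {suc i} {suc j} eq = cong suc (vertexAt-inj w sw eq)

  step-edgeAt-inj : (x∈e : x ∈ edge H e) (y∈e : y ∈ edge H e) (w : Walk y z) → ¬ e ∈ᵉ w →
                    Injective _≡_ _≡_ (edgeAt w) → Injective _≡_ _≡_ (edgeAt (step e x∈e y∈e w))
  step-edgeAt-inj _ _ _ _   _     {zero}  {zero}  _  = refl
  step-edgeAt-inj _ _ w e∉w _     {zero}  {suc j} eq =
    contradiction (subst (_∈ᵉ w) (sym eq) (edgeAt-∈ᵉ w j)) e∉w
  step-edgeAt-inj _ _ w e∉w _     {suc i} {zero}  eq =
    contradiction (subst (_∈ᵉ w) eq (edgeAt-∈ᵉ w i)) e∉w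
  step-edgeAt-inj _ _ _ _   inj-w {suc i} {suc j} eq = cong suc (inj-w eq)

  edgeAt-inj : (w : Walk x z) → Simple w → Injective _≡_ _≡_ (edgeAt w)
  edgeAt-inj (step _ x∈e y∈e w) (_ , e∉w , sw) = step-edgeAt-inj x∈e y∈e w e∉w (edgeAt-inj w sw)

  edgeAt-left : (w : Walk x z) (i : Fin (steps w)) → vertexAt w (inject₁ i) ∈ edge H (edgeAt w i)
  edgeAt-left (step _ x∈e _ _) zero    = x∈e
  edgeAt-left (step _ _ _ w)   (suc i) = edgeAt-left w i

  edgeAt-right : (w : Walk x z) (i : Fin (steps w)) → vertexAt w (suc i) ∈ edge H (edgeAt w i)
  edgeAt-right (step e _ y∈e w) zero    = subst (_∈ edge H e) (sym (vertexAt-first w)) y∈e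
  edgeAt-right (step _ _ _ w)   (suc i) = edgeAt-right w i

  ∈ᵛ⇒∈edgeAt : (w : Walk x z) → 1 ≤ steps w → u ∈ᵛ w → ∃[ i ] u ∈ edge H (edgeAt w i)
  ∈ᵛ⇒∈edgeAt (step _ x∈e _ _)              _ (inj₁ refl) = zero , x∈e
  ∈ᵛ⇒∈edgeAt (step _ _ y∈e [])             _ (inj₂ refl) = zero , y∈e
  ∈ᵛ⇒∈edgeAt (step _ _ _ w@(step _ _ _ _)) _ (inj₂ u∈w)  with ∈ᵛ⇒∈edgeAt w (s≤s z≤n) u∈w
  ... | i , u∈eᵢ = suc i , u∈eᵢ

  Simple⇒steps< : (w : Walk x z) → Simple w → steps w < n H
  Simple⇒steps< w sw = injective⇒≤ (vertexAt-inj w sw)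

  ≢⇒1≤steps : x ≢ z → (w : Walk x z) → 1 ≤ steps w
  ≢⇒1≤steps x≢x []             = contradiction refl x≢x
  ≢⇒1≤steps _   (step _ _ _ _) = s≤s z≤n

  toPath : (w : Walk x z) → Simple w → Path H
  toPath w sw = record
    { len = steps w ; vert = vertexAt w ; edg = edgeAt w
    ; edg-inj = edgeAt-inj w sw ; vert-inj = vertexAt-inj w sw
    ; inc-left = edgeAt-left w ; inc-right = edgeAt-right w }

  toCycle : (e : Edge) (x∈e : x ∈ edge H e) (y∈e : y ∈ edge H e) (w : Walk y x) →
            Simple w → ¬ e ∈ᵉ w → 1 ≤ steps w → Cycle H
  toCycle e x∈e y∈e w sw e∉w 1≤steps = record
    { len = steps (step e x∈e y∈e w) ; vert = vertexAt (step e x∈e y∈e w) ; edg = edgeAt (step e x∈e y∈e w)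
    ; edg-inj = step-edgeAt-inj x∈e y∈e w e∉w (edgeAt-inj w sw) ; vert-inj = vertexAt-inj w sw
    ; len≥2 = s≤s 1≤steps ; closed = sym (vertexAt-last w)
    ; inc-left = edgeAt-left (step e x∈e y∈e w) ; inc-right = edgeAt-right (step e x∈e y∈e w) }

  walkAlong : (l : ℕ) (vert : Fin (suc l) → Vertex) (edg : Fin l → Edge) →
              (∀ i → vert (inject₁ i) ∈ edge H (edg i)) → (∀ i → vert (suc i) ∈ edge H (edg i)) →
              (t : Fin (suc l)) → Σ (Walk (vert zero) (vert t)) (AllEdges λ f → ∃[ i ] edg i ≡ f)
  walkAlong _       _    _   _    _     zero    = [] , λ ()
  walkAlong (suc l) vert edg left right (suc t)
    with w , w-along ← walkAlong l (vert ∘ suc) (edg ∘ suc) (left ∘ suc) (right ∘ suc) t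
    = step (edg zero) (left zero) (right zero) w , [ (λ f≡e₀ → zero , sym f≡e₀) , shift ∘ w-along ]
    where
      shift : ∀ {f} → ∃[ i ] edg (suc i) ≡ f → ∃[ i ] edg i ≡ f
      shift (i , eᵢ≡f) = suc i , eᵢ≡f

  pathWalk : (p : Path H) → Walk (Path.vert p zero) (Path.vert p (fromℕ (Path.len p)))
  pathWalk p = proj₁ (walkAlong (Path.len p) (Path.vert p) (Path.edg p) (Path.inc-left p) (Path.inc-right p) _)

  module Components {P : Edge → Set} (P? : Decidable P) where

    Reach : ℕ → Vertex → Vertex → Set
    Reach zero    y x = y ≡ x
    Reach (suc t) y x = y ≡ x ⊎ ∃[ e ] P e × y ∈ edge H e × ∃[ z ] z ∈ edge H e × Reach t z x

    reach? : ∀ t y x → Dec (Reach t y x)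
    reach? zero    y x = y ≟ x
    reach? (suc t) y x =
      (y ≟ x) ⊎-dec any? λ e →
        P? e ×-dec (y ∈? edge H e) ×-dec any? λ z → (z ∈? edge H e) ×-dec reach? t z x

    Reach-refl : ∀ t → Reach t x x
    Reach-refl zero    = refl
    Reach-refl (suc t) = inj₁ refl

    Reach-mono : ∀ {t t′} → t ≤ t′ → Reach t y x → Reach t′ y x
    Reach-mono {t′ = t′} z≤n        refl        = Reach-refl t′
    Reach-mono           (s≤s _)    (inj₁ refl) = inj₁ refl
    Reach-mono           (s≤s t≤t′) (inj₂ (e , Pe , y∈e , z , z∈e , r)) =
      inj₂ (e , Pe , y∈e , z , z∈e , Reach-mono t≤t′ r)

    Reach⇒walk : ∀ t → Reach t y x → Σ (Walk y x) (AllEdges P)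
    Reach⇒walk zero    refl        = [] , λ ()
    Reach⇒walk (suc t) (inj₁ refl) = [] , λ ()
    Reach⇒walk (suc t) (inj₂ (e , Pe , y∈e , z , z∈e , r)) with Reach⇒walk t r
    ... | w , Pw = step e y∈e z∈e w , [ (λ { refl → Pe }) , Pw ]

    walk⇒Reach : (w : Walk y x) → AllEdges P w → Reach (steps w) y x
    walk⇒Reach []                 _  = refl
    walk⇒Reach (step e y∈e z∈e w) Pw =
      inj₂ (e , Pw (inj₁ refl) , y∈e , _ , z∈e , walk⇒Reach w (Pw ∘ inj₂))

    -- n H steps suffice, as a simple walk has fewer than n H steps.
    component : Vertex → Subset (n H)
    component v = toSubset (reach? (n H) v)

    ∈component⇒walk : x ∈ component v → Σ (Walk v x) (AllEdges P)
    ∈component⇒walk = Reach⇒walk (n H) ∘ ∈-toSubset⁻ (reach? (n H) _)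

    walk⇒∈component : (w : Walk v x) → AllEdges P w → x ∈ component v
    walk⇒∈component w Pw with simplify-AllEdges w Pw
    ... | s , ss , Ps = ∈-toSubset⁺ (reach? (n H) _) (Reach-mono (<⇒≤ (Simple⇒steps< s ss)) (walk⇒Reach s Ps))

    edge⊆component : x ∈ component v → P e → x ∈ edge H e → edge H e ⊆ component v
    edge⊆component x∈ Pe x∈e u∈e with ∈component⇒walk x∈
    ... | w , Pw = walk⇒∈component (w ++ single _ x∈e u∈e) (AllEdges-++ w Pw (AllEdges-single x∈e u∈e Pe))

    walk-edges⊆component : (w : Walk x z) → x ∈ component v → AllEdges P w →
                           ∀ i → edge H (edgeAt w i) ⊆ component v
    walk-edges⊆component (step e x∈e _ _)   x∈ Pw zero    = edge⊆component x∈ (Pw (inj₁ refl)) x∈e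
    walk-edges⊆component (step e x∈e y∈e w) x∈ Pw (suc i) =
      walk-edges⊆component w (edge⊆component x∈ (Pw (inj₁ refl)) x∈e y∈e) (Pw ∘ inj₂) i

module OnCycle {k : ℕ} {H : KGraph k} (C : Cycle H) where
  open Walks H

  private variable
    u x y z : Vertex
    e : Edge

  OnC : Vertex → Set
  OnC = VertexOf H C

  InC : Edge → Set
  InC = EdgeOf H C

  OffC : Edge → Set
  OffC e = ¬ InC e

  onC? : Decidable OnC
  onC? x = any? λ i → x ∈? edge H (Cycle.edg C i)

  inC? : Decidable InC
  inC? f = any? λ i → Cycle.edg C i ≟ f

  offC? : Decidable OffC
  offC? = ¬? ∘ inC?

  offC-at-offVertex : ¬ OnC x → x ∈ edge H e → OffC e
  offC-at-offVertex x∉C x∈e (i , eᵢ≡e) = x∉C (i , subst (λ f → _ ∈ edge H f) (sym eᵢ≡e) x∈e)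

  firstEdge : Fin (Cycle.len C)
  firstEdge = fromℕ< (≤-trans (s≤s z≤n) (Cycle.len≥2 C))

  onC-firstVertex : OnC (Cycle.vert C (inject₁ firstEdge))
  onC-firstVertex = firstEdge , Cycle.inc-left C firstEdge

  edges-nonempty : ∀ e → Nonempty (edge H e)
  edges-nonempty e =
    nonempty-sameSize (trans (edge-size H _) (sym (edge-size H e))) (_ , Cycle.inc-left C firstEdge)

  walkAlongC : (t : Fin (suc (Cycle.len C))) → Σ (Walk (Cycle.vert C zero) (Cycle.vert C t)) (AllEdges InC)
  walkAlongC = walkAlong (Cycle.len C) (Cycle.vert C) (Cycle.edg C) (Cycle.inc-left C) (Cycle.inc-right C)

  cycleWalk : OnC x → OnC y → Σ (Walk x y) (AllEdges InC)
  cycleWalk (i , x∈eᵢ) (j , y∈eⱼ)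
    with (toᵢ , inCᵢ) ← walkAlongC (inject₁ i) | (toⱼ , inCⱼ) ← walkAlongC (inject₁ j)
    = xᵢ ++ reverse toᵢ ++ toⱼ ++ yⱼ ,
      AllEdges-++ xᵢ xᵢ-inC
        (AllEdges-++ (reverse toᵢ) (AllEdges-reverse toᵢ inCᵢ) (AllEdges-++ toⱼ inCⱼ yⱼ-inC))
    where
      left = Cycle.inc-left C
      xᵢ = single _ x∈eᵢ (left i)
      yⱼ = single _ (left j) y∈eⱼ
      xᵢ-inC = AllEdges-single {P = InC} x∈eᵢ (left i) (i , refl)
      yⱼ-inC = AllEdges-single {P = InC} (left j) y∈eⱼ (j , refl)

  InC-walk-onC : OnC x → (w : Walk x z) → AllEdges InC w → u ∈ᵛ w → OnC u
  InC-walk-onC x∈C []               _   refl        = x∈C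
  InC-walk-onC x∈C (step _ _ _ _)   _   (inj₁ refl) = x∈C
  InC-walk-onC _   (step e _ y∈e w) inC (inj₂ u∈w)  with inC (inj₁ refl)
  ... | i , eᵢ≡e = InC-walk-onC (i , subst (λ f → _ ∈ edge H f) (sym eᵢ≡e) y∈e) w (inC ∘ inj₂) u∈w

  record FirstVisit (w : Walk y z) : Set where
    field
      {hit}         : Vertex
      prefix        : Walk y hit
      hit-onC       : OnC hit
      prefix-simple : Simple prefix
      prefix-⊆ᵛ     : prefix ⊆ᵛ w
      prefix-⊆ᵉ     : prefix ⊆ᵉ w
      hit-first     : ∀ {u} → u ∈ᵛ prefix → OnC u → u ≡ hit

  visitAtStart : (w : Walk y z) → OnC y → FirstVisit w
  visitAtStart w y∈C = record
    { prefix = [] ; hit-onC = y∈C ; prefix-simple = tt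
    ; prefix-⊆ᵛ = λ { refl → start-∈ᵛ w } ; prefix-⊆ᵉ = λ () ; hit-first = λ u≡y _ → u≡y }

  firstVisit : (w : Walk y z) → Simple w → OnC z → FirstVisit w
  firstVisit []                           _                     z∈C = visitAtStart [] z∈C
  firstVisit w@(step {x = y} e y∈e u∈e w′) (y∉w′ , e∉w′ , sw′) z∈C with onC? y
  ... | yes y∈C = visitAtStart w y∈C
  ... | no y∉C = record
    { prefix        = step e y∈e u∈e prefix
    ; hit-onC       = hit-onC
    ; prefix-simple = y∉w′ ∘ prefix-⊆ᵛ , e∉w′ ∘ prefix-⊆ᵉ , prefix-simple
    ; prefix-⊆ᵛ     = [ inj₁ , inj₂ ∘ prefix-⊆ᵛ ]
    ; prefix-⊆ᵉ     = [ inj₁ , inj₂ ∘ prefix-⊆ᵉ ]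
    ; hit-first     = [ (λ { refl u∈C → contradiction u∈C y∉C }) , hit-first ]
    }
    where open FirstVisit (firstVisit w′ sw′ z∈C)

  offCycleWalkFromCycle : (w : Walk x z) → OnC z → ∃[ b ] OnC b × Σ (Walk b x) (AllEdges OffC)
  offCycleWalkFromCycle []                         z∈C = _ , z∈C , [] , λ ()
  offCycleWalkFromCycle (step {x = x} e x∈e y∈e w) z∈C with onC? x
  ... | yes x∈C = x , x∈C , [] , λ ()
  ... | no x∉C with offCycleWalkFromCycle w z∈C
  ...   | b , b∈C , wb , off = b , b∈C , wb ++ single e y∈e x∈e ,
                               AllEdges-++ wb off (AllEdges-single y∈e x∈e (offC-at-offVertex x∉C x∈e))

EdgeOf-⊆⇒len≤ : ∀ {k} {H : KGraph k} (C D : Cycle H) →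
                (∀ e → EdgeOf H C e → EdgeOf H D e) → Cycle.len C ≤ Cycle.len D
EdgeOf-⊆⇒len≤ C D C⊆D = injective⇒≤ {f = position} λ {i} {j} eq → Cycle.edg-inj C (begin
    Cycle.edg C i             ≡⟨ sym (position-edg i) ⟩
    Cycle.edg D (position i)  ≡⟨ cong (Cycle.edg D) eq ⟩
    Cycle.edg D (position j)  ≡⟨ position-edg j ⟩
    Cycle.edg C j             ∎)
  where
    open ≡-Reasoning
    position : Fin (Cycle.len C) → Fin (Cycle.len D)
    position i = proj₁ (C⊆D _ (i , refl))
    position-edg : ∀ i → Cycle.edg D (position i) ≡ Cycle.edg C i
    position-edg i = proj₂ (C⊆D _ (i , refl))

module InCactus {k : ℕ} {H : KGraph k}
                (cactus : ∀ C₁ C₂ → DistinctCycles H C₁ C₂ → AtMostOneCommonVertex H C₁ C₂) where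
  open Walks H

  private variable
    x y : Vertex

  linear : (C : Cycle H) → 3 ≤ Cycle.len C → LinearCycle H C
  linear C 3≤len i j eᵢ≢eⱼ x y x∈eᵢ x∈eⱼ y∈eᵢ y∈eⱼ with x ≟ y
  ... | yes x≡y = x≡y
  ... | no  x≢y = cactus C D C≢D x y (i , x∈eᵢ) (zero , x∈eᵢ) (j , y∈eⱼ) (zero , y∈eᵢ)
    where
      D : Cycle H
      D = toCycle _ x∈eᵢ y∈eᵢ (single _ y∈eⱼ x∈eⱼ) (x≢y ∘ sym , (λ ()) , tt) [ eᵢ≢eⱼ , (λ ()) ]
                  (s≤s z≤n)
      C≢D : DistinctCycles H C D
      C≢D same = contradiction (≤-trans 3≤len (EdgeOf-⊆⇒len≤ C D (proj₁ ∘ same))) λ { (s≤s (s≤s ())) }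

  module _ (C : Cycle H) where
    open OnCycle C

    simpleOffCycleWalk⇒≡ : OnC x → OnC y → (w : Walk x y) → Simple w → AllEdges OffC w → y ≡ x
    simpleOffCycleWalk⇒≡ _   _   []                     _                  _   = refl
    simpleOffCycleWalk⇒≡ x∈C y∈C (step e₀ x∈e₀ z∈e₀ w) (x∉w , e₀∉w , sw) off
      with fv ← firstVisit w sw y∈C
      with Q , Q-simple , Q-inC ← uncurry simplify-AllEdges (cycleWalk (FirstVisit.hit-onC fv) x∈C)
      = contradiction (subst (_∈ᵛ w) (sym x≡hit) (prefix-⊆ᵛ (end-∈ᵛ prefix))) x∉w
      where
        open FirstVisit fv
        loop = prefix ++ Q
        loop-simple : Simple loop
        loop-simple = ++-Simple prefix prefix-simple Q-simple
          (λ u∈P u∈Q → hit-first u∈P (InC-walk-onC hit-onC Q Q-inC u∈Q))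
          (λ f∈P f∈Q → off (inj₂ (prefix-⊆ᵉ f∈P)) (Q-inC f∈Q))
        e₀∉loop : ¬ e₀ ∈ᵉ loop
        e₀∉loop = [ e₀∉w ∘ prefix-⊆ᵉ , off (inj₁ refl) ∘ Q-inC ] ∘ ∈ᵉ-++⁻ prefix
        z≢x : _ ≢ _
        z≢x refl = x∉w (start-∈ᵛ w)
        D : Cycle H
        D = toCycle e₀ x∈e₀ z∈e₀ loop loop-simple e₀∉loop (≢⇒1≤steps z≢x loop)
        C≢D : DistinctCycles H C D
        C≢D same = off (inj₁ refl) (proj₂ (same e₀) (zero , refl))
        x≡hit : _ ≡ hit
        x≡hit = cactus C D C≢D _ hit x∈C (zero , x∈e₀) hit-onC
          (∈ᵛ⇒∈edgeAt (step e₀ x∈e₀ z∈e₀ loop) (s≤s z≤n) (inj₂ (∈ᵛ-++⁺ʳ prefix (start-∈ᵛ Q))))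

    offCycleWalk⇒≡ : OnC x → OnC y → (w : Walk x y) → AllEdges OffC w → y ≡ x
    offCycleWalk⇒≡ x∈C y∈C w off with simplify-AllEdges w off
    ... | s , ss , off′ = simpleOffCycleWalk⇒≡ x∈C y∈C s ss off′

    open Components offC?
    open Enumeration (enumerate onC?) renaming (size to s; elem to v)

    W : Fin s → Subset (n H)
    W i = component (v i)

    W∩C⊆v : ∀ i x → x ∈ W i → OnC x → x ≡ v i
    W∩C⊆v i x x∈Wᵢ x∈C = uncurry (offCycleWalk⇒≡ (elem-sat i) x∈C) (∈component⇒walk x∈Wᵢ)

    W-disjoint : ∀ i j → i ≢ j → ∀ x → x ∈ W i → x ∈ W j → ⊥
    W-disjoint i j i≢j x x∈Wᵢ x∈Wⱼ with ∈component⇒walk x∈Wᵢ | ∈component⇒walk x∈Wⱼ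
    ... | wᵢ , offᵢ | wⱼ , offⱼ =
      i≢j (sym (elem-inj (offCycleWalk⇒≡ (elem-sat i) (elem-sat j) (wᵢ ++ reverse wⱼ)
                                          (AllEdges-++ wᵢ offᵢ (AllEdges-reverse wⱼ offⱼ)))))

    W-connected : ∀ i → ConnectedOn H (W i)
    W-connected i x y x∈Wᵢ y∈Wᵢ with ∈component⇒walk x∈Wᵢ | ∈component⇒walk y∈Wᵢ
    ... | wx , offx | wy , offy
      with p , p-simple , offp ←
             simplify-AllEdges (reverse wx ++ wy) (AllEdges-++ (reverse wx) (AllEdges-reverse wx offx) offy)
      = toPath p p-simple , vertexAt-first p , vertexAt-last p , walk-edges⊆component p x∈Wᵢ offp

    W-covers : Connected H → ∀ x → ∃[ i ] x ∈ W i
    W-covers conn x with conn x (Cycle.vert C (inject₁ firstEdge))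
    ... | p , refl , end≡ with offCycleWalkFromCycle (pathWalk p) (subst OnC (sym end≡) onC-firstVertex)
    ...   | b , b∈C , wb , offb with elem-onto b b∈C
    ...     | i , refl = i , walk⇒∈component wb offb

    edges-covered : Connected H → ∀ e → InC e ⊎ ∃[ i ] edge H e ⊆ W i
    edges-covered conn e with inC? e
    ... | yes e∈C = inj₁ e∈C
    ... | no  e∉C with edges-nonempty e
    ...   | x , x∈e with W-covers conn x
    ...     | i , x∈Wᵢ = inj₂ (i , edge⊆component x∈Wᵢ e∉C x∈e)

    decomposition : Connected H → Decomposition H C
    decomposition conn =
      s , v , W , elem-inj , elem-sat , (λ i → walk⇒∈component [] λ ()) , W∩C⊆v , W-disjoint ,
      W-connected , inj₂ ∘ W-covers conn , edges-covered conn

lemma2p7 : (k : ℕ) (H : KGraph k) → Cactus H → (C : Cycle H) →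
    ((3 ≤ Cycle.len C → LinearCycle H C) × Decomposition H C)
lemma2p7 k H (conn , cactus) C = linear C , decomposition C conn
  where open InCactus cactus
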